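{- Let $Q^+(7,2)$ be a non-degenerate hyperbolic quadric of ${\rm PG}(7,2)$. (i) Let $NO^+(8,2)$ be the graph whose vertices are the points of ${\rm PG}(7,2)\setminus Q^+(7,2)$, two vertices being adjacent if and only if the line joining them is tangent to $Q^+(7,2)$. (ii) Fix a generator (solid) $\Pi$ of $Q^+(7,2)$ and let $\mathcal G_3$ be the graph whose vertices are the points of $Q^+(7,2)\setminus \Pi$, two distinct vertices $P_1,P_2$ being adjacent if and only if either the line $\langle P_1,P_2\rangle$ is secant to $Q^+(7,2)$, or it is contained in $Q^+(7,2)$ and meets $\Pi$ in a point. Then every clique of $NO^+(8,2)$ and every clique of $\mathcal G_3$ has at most $8$ vertices.
   Context: A generator of $Q^+(7,2)$ is a solid (3-dimensional projective subspace) contained in the quadric. A clique is a set of pairwise adjacent vertices. A tangent line to the quadric is a line meeting it in exactly one point (equivalently, for lines through non-quadric points here, joining two points $P,Q$ with $P\in Q^\perp$, where $\perp$ is the polarity of the quadric). -}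

module Defs where

open import Data.Bool using (Bool; true; false; _xor_; _∧_; not; if_then_else_)
open import Data.Nat using (ℕ; _+_)
open import Data.Fin using (Fin)
open import Data.Vec using (Vec; zipWith; replicate; lookup; foldr)
open import Data.List using (List; concatMap; map; allFin)
import Data.List as L
open import Data.Product using (Σ; ∃; _×_)
open import Data.Sum using (_⊎_)
open import Relation.Binary.PropositionalEquality using (_≡_; _≢_)
open import Relation.Nullary using (¬_)

-- Vectors of GF(2)^8 (GF(2) = Bool with xor as + and ∧ as ·).
V : Set
V = Vec Bool 8

_⊕_ : V → V → V
_⊕_ = zipWith _xor_

0v : V
0v = replicate 8 false

-- Projective points of PG(7,2) = nonzero vectors of GF(2)^8.
IsPoint : V → Set
IsPoint x = x ≢ 0v

bsum : List Bool → Bool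
bsum = L.foldr _xor_ false

-- A quadratic form on GF(2)^8, given by coefficients a_ij:
-- Q(x) = Σ_{i,j} a_ij x_i x_j  (every quadratic form arises this way).
QForm : Set
QForm = Vec (Vec Bool 8) 8

evalQ : QForm → V → Bool
evalQ a x = bsum (concatMap (λ i → map (λ j → lookup (lookup a i) j ∧ (lookup x i ∧ lookup x j)) (allFin 8)) (allFin 8))

polar : QForm → V → V → Bool
polar a x y = evalQ a (x ⊕ y) xor (evalQ a x xor evalQ a y)

OnQ : QForm → V → Set
OnQ a x = evalQ a x ≡ false

NonDegenerate : QForm → Set
NonDegenerate a = ∀ x → x ≢ 0v → Σ V (λ y → polar a x y ≡ true)

lincomb : Vec V 4 → Vec Bool 4 → V
lincomb g c = foldr _ _⊕_ 0v (zipWith (λ ci gi → if ci then gi else 0v) c g)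

InSpan : Vec V 4 → V → Set
InSpan g x = Σ (Vec Bool 4) (λ c → lincomb g c ≡ x)

IsGenerator : QForm → Vec V 4 → Set
IsGenerator a g =
  (∀ c → lincomb g c ≡ 0v → c ≡ replicate 4 false) ×
  (∀ c → OnQ a (lincomb g c))

-- non-degenerate hyperbolic quadric Q^+(7,2): non-degenerate with Witt index 4
Hyperbolic : QForm → Set
Hyperbolic a = NonDegenerate a × Σ (Vec V 4) (IsGenerator a)

b2n : Bool → ℕ
b2n true = 1
b2n false = 0

-- number of points of the line <x,y> = {x, y, x+y} lying on the quadric
meetCount : QForm → V → V → ℕ
meetCount a x y = b2n (not (evalQ a x)) + (b2n (not (evalQ a y)) + b2n (not (evalQ a (x ⊕ y))))

Tangent Secant ContainedInQ : QForm → V → V → Set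
Tangent a x y = meetCount a x y ≡ 1
Secant a x y = meetCount a x y ≡ 2
ContainedInQ a x y = meetCount a x y ≡ 3

MeetsSpan : Vec V 4 → V → V → Set
MeetsSpan g x y = InSpan g x ⊎ (InSpan g y ⊎ InSpan g (x ⊕ y))

VertexNO : QForm → V → Set
VertexNO a x = IsPoint x × ¬ OnQ a x

AdjNO : QForm → V → V → Set
AdjNO a x y = x ≢ y × Tangent a x y

VertexG3 : QForm → Vec V 4 → V → Set
VertexG3 a g x = IsPoint x × (OnQ a x × ¬ InSpan g x)

AdjG3 : QForm → Vec V 4 → V → V → Set
AdjG3 a g x y = x ≢ y × (Secant a x y ⊎ (ContainedInQ a x y × MeetsSpan g x y))

{-# OPTIONS --safe #-}
module Submission where

-- A totally isotropic subset of a nondegenerate symplectic space of order 4ⁿ over GF(2) has at most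
-- 2ⁿ elements: its span has a basis b and a family d with B(bᵢ, dⱼ) = δᵢⱼ, b ∪ d is independent, so
-- 4^dim ≤ 4ⁿ.  Hence if S is isotropic, e ⊥ S and S ∩ (e + S) = ∅, then S ∪ (e + S) gives 2|S| ≤ 2ⁿ.
--
-- Let B be the polar form of Q, a symplectic form on GF(2)⁸.  Two nonsingular points span a tangent
-- line iff they are B-orthogonal, so a clique of NO⁺(8,2) is isotropic, and for a point x₀ of it
-- Q(x₀ + s) = Q x₀ + Q s = 0 keeps x₀ + S away from S: |S| ≤ 8.
--
-- In 𝒢₃ the clique points are singular and outside Π, and B(x, y) = 0 forces the line ⟨x, y⟩ into the
-- quadric, hence x + y ∈ Π: on a clique, orthogonality is congruence modulo Π.  As Π = Π^⊥, the map
-- φ x = (B(x, gᵢ))ᵢ identifies V/Π with Bool⁴.  Fixing a clique point rep x in each class, the map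
-- x ↦ (φ x, coordinates of x + rep x in Π) sends the clique injectively onto an isotropic subset of
-- Bool⁴ × Bool⁴ with the form (a, h)·(a′, h′) = a·h′ + a′·h, orthogonal to e = (φ x₀, 0) and disjoint
-- from its translate by e, because Q(x + x₀ + y) = B(x, x₀) + B(x, y) + B(x₀, y) for singular x, x₀, y.

open import Defs
open import Data.Nat using (_≤_)
open import Data.List using (List; length)
open import Data.List.Relation.Unary.All using (All)
open import Data.List.Relation.Unary.AllPairs using (AllPairs)
open import Data.Product using (_×_)
open import Data.Vec using (Vec)

open import Level using (0ℓ)
open import Function using (_∘_)
open import Data.Empty using (⊥)
open import Data.Bool using (Bool; true; false; _xor_; _∧_; not; if_then_else_)
open import Data.Bool.Properties using (xor-∧-commutativeRing; xor-same; xor-comm; xor-assoc; ¬-not)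
import Data.Bool.Properties as Bool
open import Data.Maybe using (Maybe; just; nothing)
open import Data.Nat using (ℕ; zero; suc; _+_; _*_; _^_; z≤n; s≤s)
open import Data.Nat.Properties using (≤-trans; ≤-reflexive; ≰⇒>; <⇒≱; *-mono-<; +-mono-<; +-identityʳ; _≤?_; m^n>0; +-cancelʳ-≤; module ≤-Reasoning)
open import Data.Fin using (Fin)
import Data.Fin as Fin
open import Data.Vec using ([]; _∷_; zipWith; replicate; lookup; map; foldr)
open import Data.Vec.Properties using (lookup-map; lookup-zipWith; lookup-replicate; map-cong; map-∘; tabulate∘lookup; tabulate-cong; ∷-injectiveˡ; ∷-injectiveʳ)
import Data.Vec.Properties as Vec
open import Data.List using ([]; _∷_; _++_; [_]; concat; allFin; cartesianProduct)
import Data.List as List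
open import Data.List.Properties using (length-++; length-map)
open import Data.List.Membership.Propositional using (_∈_; _∉_; find; lose)
open import Data.List.Membership.Propositional.Properties using (∈-map⁺; ∈-map⁻; ∈-++⁺ˡ; ∈-++⁺ʳ; ∈-++⁻; ∈-cartesianProduct⁺)
import Data.List.Membership.DecPropositional as DecMembership
open import Data.List.Relation.Binary.Subset.Propositional using (_⊆_)
open import Data.List.Relation.Unary.Any using (Any; here; there; any?)
import Data.List.Relation.Unary.All as All
import Data.List.Relation.Unary.All.Properties as All
import Data.List.Relation.Unary.AllPairs as AllPairs
open import Data.List.Relation.Unary.AllPairs using ([]; _∷_)
open import Data.List.Relation.Unary.All using ([]; _∷_)
open import Data.List.Relation.Unary.Unique.Propositional using (Unique)
import Data.List.Relation.Unary.Unique.Propositional.Properties as Unique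
open import Data.Product using (∃; _,_; proj₁; proj₂)
open import Data.Product.Properties using () renaming (≡-dec to ×-≡-dec)
open import Data.Sum using (_⊎_; inj₁; inj₂)
open import Relation.Binary.Definitions using (DecidableEquality)
open import Relation.Binary.PropositionalEquality using (_≡_; _≢_; refl; sym; trans; cong; cong₂; subst; module ≡-Reasoning)
open import Relation.Nullary using (¬_; Dec; yes; no; contradiction)
open import Relation.Nullary.Decidable using (decidable-stable)
open import Algebra.Bundles using (CommutativeSemigroup)
open import Relation.Binary.PropositionalEquality.Algebra using (isMagma)
import Algebra.Properties.CommutativeSemigroup as CommutativeSemigroupProperties
open import Tactic.RingSolver.Core.AlmostCommutativeRing using (AlmostCommutativeRing; fromCommutativeRing)
open import Tactic.RingSolver using (solve-∀)

private
  variable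
    A B : Set
    k : ℕ

AllPairs-lookup : ∀ {R : A → A → Set} {xs x y} → AllPairs R xs → x ∈ xs → y ∈ xs → x ≡ y ⊎ R x y ⊎ R y x
AllPairs-lookup (_ ∷ _) (here refl) (here refl) = inj₁ refl
AllPairs-lookup (rx ∷ _) (here refl) (there y∈) = inj₂ (inj₁ (All.lookup rx y∈))
AllPairs-lookup (rx ∷ _) (there x∈) (here refl) = inj₂ (inj₂ (All.lookup rx x∈))
AllPairs-lookup (_ ∷ rs) (there x∈) (there y∈) = AllPairs-lookup rs x∈ y∈

∀-∈-map : ∀ {P : B → Set} (f : A → B) {xs} → (∀ {x} → x ∈ xs → P (f x)) → ∀ {y} → y ∈ List.map f xs → P y
∀-∈-map f h y∈ with ∈-map⁻ f y∈
... | _ , x∈ , refl = h x∈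

Unique-map⁺-injectiveOn : ∀ (f : A → B) {xs} → (∀ {x y} → x ∈ xs → y ∈ xs → f x ≡ f y → x ≡ y) →
  Unique xs → Unique (List.map f xs)
Unique-map⁺-injectiveOn f inj [] = []
Unique-map⁺-injectiveOn f inj (x∉ ∷ u) =
  All.map⁺ (All.tabulate λ y∈ fx≡fy → All.lookup x∉ y∈ (inj (here refl) (there y∈) fx≡fy))
  ∷ Unique-map⁺-injectiveOn f (λ x∈ y∈ → inj (there x∈) (there y∈)) u

remove : ∀ {x : A} (ys : List A) → x ∈ ys → List A
remove (_ ∷ ys) (here _) = ys
remove (y ∷ ys) (there x∈) = y ∷ remove ys x∈

length-remove : ∀ {x : A} (ys : List A) (x∈ : x ∈ ys) → suc (length (remove ys x∈)) ≡ length ys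
length-remove (_ ∷ _) (here _) = refl
length-remove (_ ∷ ys) (there x∈) = cong suc (length-remove ys x∈)

∈-remove : ∀ {x z : A} (ys : List A) (x∈ : x ∈ ys) → z ∈ ys → z ≢ x → z ∈ remove ys x∈
∈-remove (_ ∷ _) (here refl) (here refl) z≢x = contradiction refl z≢x
∈-remove (_ ∷ _) (here refl) (there z∈) _ = z∈
∈-remove (_ ∷ _) (there _) (here refl) _ = here refl
∈-remove (_ ∷ ys) (there x∈) (there z∈) z≢x = there (∈-remove ys x∈ z∈ z≢x)

Unique-⊆⇒length≤ : ∀ {xs ys : List A} → Unique xs → xs ⊆ ys → length xs ≤ length ys
Unique-⊆⇒length≤ [] _ = z≤n
Unique-⊆⇒length≤ {xs = x ∷ xs} {ys} (x∉ ∷ u) xs⊆ys = ≤-trans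
  (s≤s (Unique-⊆⇒length≤ u λ z∈ → ∈-remove ys x∈ys (xs⊆ys (there z∈)) (All.lookup x∉ z∈ ∘ sym)))
  (≤-reflexive (length-remove ys x∈ys))
  where
  x∈ys : x ∈ ys
  x∈ys = xs⊆ys (here refl)

length-cartesianProduct : ∀ (xs : List A) (ys : List B) → length (cartesianProduct xs ys) ≡ length xs * length ys
length-cartesianProduct [] ys = refl
length-cartesianProduct (x ∷ xs) ys = begin
  length (List.map (x ,_) ys ++ cartesianProduct xs ys)
    ≡⟨ length-++ (List.map (x ,_) ys) ⟩
  length (List.map (x ,_) ys) + length (cartesianProduct xs ys)
    ≡⟨ cong₂ _+_ (length-map (x ,_) ys) (length-cartesianProduct xs ys) ⟩
  length ys + length xs * length ys ∎
  where open ≡-Reasoning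

choose : ∀ {P : A → Set} {xs} → Dec (Any P xs) → A → A
choose (yes found) _ = proj₁ (find found)
choose (no _) default = default

choose-spec : ∀ {P : A → Set} {xs} (found? : Dec (Any P xs)) default → Any P xs →
  choose found? default ∈ xs × P (choose found? default)
choose-spec (yes found) _ _ = proj₂ (find found)
choose-spec (no none) _ found = contradiction found none

false⇔false⇒≡ : ∀ {p q} → (p ≡ false → q ≡ false) → (q ≡ false → p ≡ false) → p ≡ q
false⇔false⇒≡ {false} {false} _ _ = refl
false⇔false⇒≡ {false} {true} p⇒q _ = sym (p⇒q refl)
false⇔false⇒≡ {true} {false} _ q⇒p = q⇒p refl
false⇔false⇒≡ {true} {true} _ _ = refl

m*m≤n*n⇒m≤n : ∀ {m n} → m * m ≤ n * n → m ≤ n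
m*m≤n*n⇒m≤n {m} {n} mm≤nn with m ≤? n
... | yes m≤n = m≤n
... | no m≰n = let n<m = ≰⇒> m≰n in contradiction mm≤nn (<⇒≱ (*-mono-< n<m n<m))

m+m≤n+n⇒m≤n : ∀ {m n} → m + m ≤ n + n → m ≤ n
m+m≤n+n⇒m≤n {m} {n} mm≤nn with m ≤? n
... | yes m≤n = m≤n
... | no m≰n = let n<m = ≰⇒> m≰n in contradiction mm≤nn (<⇒≱ (+-mono-< n<m n<m))

-- Vectors over GF(2)

allVec : (k : ℕ) → List (Vec Bool k)
allVec zero = [ [] ]
allVec (suc k) = List.map (false ∷_) (allVec k) ++ List.map (true ∷_) (allVec k)

∈-allVec : (u : Vec Bool k) → u ∈ allVec k
∈-allVec [] = here refl
∈-allVec {suc k} (false ∷ u) = ∈-++⁺ˡ (∈-map⁺ (false ∷_) (∈-allVec u))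
∈-allVec {suc k} (true ∷ u) = ∈-++⁺ʳ (List.map (false ∷_) (allVec k)) (∈-map⁺ (true ∷_) (∈-allVec u))

length-allVec : ∀ k → length (allVec k) ≡ 2 ^ k
length-allVec zero = refl
length-allVec (suc k) = begin
  length (List.map (false ∷_) (allVec k) ++ List.map (true ∷_) (allVec k))
    ≡⟨ length-++ (List.map (false ∷_) (allVec k)) ⟩
  length (List.map (false ∷_) (allVec k)) + length (List.map (true ∷_) (allVec k))
    ≡⟨ cong₂ _+_ (length-map (false ∷_) (allVec k)) (length-map (true ∷_) (allVec k)) ⟩
  length (allVec k) + length (allVec k)
    ≡⟨ cong (λ n → n + n) (length-allVec k) ⟩
  2 ^ k + 2 ^ k
    ≡⟨ cong (2 ^ k +_) (sym (+-identityʳ (2 ^ k))) ⟩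
  2 ^ suc k ∎
  where open ≡-Reasoning

allVec-unique : ∀ k → Unique (allVec k)
allVec-unique zero = [] ∷ []
allVec-unique (suc k) = Unique.++⁺ (cons⁺ false) (cons⁺ true) disjoint
  where
  cons⁺ : ∀ b → Unique (List.map (b ∷_) (allVec k))
  cons⁺ b = Unique.map⁺ ∷-injectiveʳ (allVec-unique k)
  disjoint : ∀ {u} → u ∈ List.map (false ∷_) (allVec k) × u ∈ List.map (true ∷_) (allVec k) → ⊥
  disjoint (u∈ , u∈′) with ∈-map⁻ (false ∷_) u∈ | ∈-map⁻ (true ∷_) u∈′
  ... | _ , _ , refl | _ , _ , ()

GF₂ : AlmostCommutativeRing 0ℓ 0ℓ
GF₂ = fromCommutativeRing xor-∧-commutativeRing isZero
  where
  isZero : (b : Bool) → Maybe (false ≡ b)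
  isZero false = just refl
  isZero true = nothing

xor-interchange : ∀ a b c d → (a xor b) xor (c xor d) ≡ (a xor c) xor (b xor d)
xor-interchange = solve-∀ GF₂

infixl 6 _⊻_
_⊻_ : Vec Bool k → Vec Bool k → Vec Bool k
_⊻_ = zipWith _xor_

0ᵛ : Vec Bool k
0ᵛ = replicate _ false

⊻-assoc : (u v w : Vec Bool k) → (u ⊻ v) ⊻ w ≡ u ⊻ (v ⊻ w)
⊻-assoc [] [] [] = refl
⊻-assoc (a ∷ u) (b ∷ v) (c ∷ w) = cong₂ _∷_ (xor-assoc a b c) (⊻-assoc u v w)

⊻-comm : (u v : Vec Bool k) → u ⊻ v ≡ v ⊻ u
⊻-comm [] [] = refl
⊻-comm (a ∷ u) (b ∷ v) = cong₂ _∷_ (xor-comm a b) (⊻-comm u v)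

⊻-identityˡ : (u : Vec Bool k) → 0ᵛ ⊻ u ≡ u
⊻-identityˡ [] = refl
⊻-identityˡ (a ∷ u) = cong (a ∷_) (⊻-identityˡ u)

⊻-self : (u : Vec Bool k) → u ⊻ u ≡ 0ᵛ
⊻-self [] = refl
⊻-self (a ∷ u) = cong₂ _∷_ (xor-same a) (⊻-self u)

⊻≡0ᵛ⇒≡ : (u v : Vec Bool k) → u ⊻ v ≡ 0ᵛ → u ≡ v
⊻≡0ᵛ⇒≡ [] [] _ = refl
⊻≡0ᵛ⇒≡ (a ∷ u) (b ∷ v) eq = cong₂ _∷_ (xor≡false a b (∷-injectiveˡ eq)) (⊻≡0ᵛ⇒≡ u v (∷-injectiveʳ eq))
  where
  xor≡false : ∀ a b → a xor b ≡ false → a ≡ b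
  xor≡false false false _ = refl
  xor≡false true true _ = refl

map≡0ᵛ : (f : A → Bool) (ws : Vec A k) → (∀ i → f (lookup ws i) ≡ false) → map f ws ≡ 0ᵛ
map≡0ᵛ f [] _ = refl
map≡0ᵛ f (w ∷ ws) h = cong₂ _∷_ (h Fin.zero) (map≡0ᵛ f ws (h ∘ Fin.suc))

Vec-ext : {u v : Vec A k} → (∀ i → lookup u i ≡ lookup v i) → u ≡ v
Vec-ext {u = u} {v} h = trans (sym (tabulate∘lookup u)) (trans (tabulate-cong h) (tabulate∘lookup v))

infixl 7 _·_
_·_ : Vec Bool k → Vec Bool k → Bool
[] · [] = false
(a ∷ u) · (b ∷ v) = (a ∧ b) xor (u · v)

·-comm : (u v : Vec Bool k) → u · v ≡ v · u
·-comm [] [] = refl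
·-comm (a ∷ u) (b ∷ v) = cong₂ _xor_ (Bool.∧-comm a b) (·-comm u v)

·-⊻ˡ : (u u′ v : Vec Bool k) → (u ⊻ u′) · v ≡ u · v xor u′ · v
·-⊻ˡ [] [] [] = refl
·-⊻ˡ (a ∷ u) (a′ ∷ u′) (b ∷ v) = trans (cong (((a xor a′) ∧ b) xor_) (·-⊻ˡ u u′ v)) (step a a′ b (u · v) (u′ · v))
  where
  step : ∀ a a′ b s s′ → ((a xor a′) ∧ b) xor (s xor s′) ≡ ((a ∧ b) xor s) xor ((a′ ∧ b) xor s′)
  step = solve-∀ GF₂

·-⊻ʳ : (u v v′ : Vec Bool k) → u · (v ⊻ v′) ≡ u · v xor u · v′
·-⊻ʳ u v v′ = trans (·-comm u (v ⊻ v′)) (trans (·-⊻ˡ v v′ u) (cong₂ _xor_ (·-comm v u) (·-comm v′ u)))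

·-zeroʳ : (u : Vec Bool k) → u · 0ᵛ ≡ false
·-zeroʳ [] = refl
·-zeroʳ (a ∷ u) = trans (cong (_xor u · 0ᵛ) (Bool.∧-zeroʳ a)) (·-zeroʳ u)

δ : Fin k → Fin k → Bool
δ Fin.zero Fin.zero = true
δ Fin.zero (Fin.suc _) = false
δ (Fin.suc _) Fin.zero = false
δ (Fin.suc i) (Fin.suc j) = δ i j

δ-sym : (i j : Fin k) → δ i j ≡ δ j i
δ-sym Fin.zero Fin.zero = refl
δ-sym Fin.zero (Fin.suc _) = refl
δ-sym (Fin.suc _) Fin.zero = refl
δ-sym (Fin.suc i) (Fin.suc j) = δ-sym i j

·-unit : (u w : Vec Bool k) (i : Fin k) → (∀ j → lookup w j ≡ δ i j) → u · w ≡ lookup u i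
·-unit (a ∷ u) (b ∷ w) Fin.zero hw rewrite hw Fin.zero = begin
  (a ∧ true) xor u · w ≡⟨ cong₂ _xor_ (Bool.∧-identityʳ a) (cong (u ·_) w≡0ᵛ) ⟩
  a xor u · 0ᵛ         ≡⟨ cong (a xor_) (·-zeroʳ u) ⟩
  a xor false          ≡⟨ Bool.xor-identityʳ a ⟩
  a                    ∎
  where
  open ≡-Reasoning
  w≡0ᵛ : w ≡ 0ᵛ
  w≡0ᵛ = Vec-ext λ j → trans (hw (Fin.suc j)) (sym (lookup-replicate j false))
·-unit (a ∷ u) (b ∷ w) (Fin.suc i) hw rewrite hw Fin.zero =
  trans (cong (_xor u · w) (Bool.∧-zeroʳ a)) (·-unit u w i (hw ∘ Fin.suc))

·-nondegenerate : (u : Vec Bool k) → u ≢ 0ᵛ → ∃ λ w → u · w ≡ true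
·-nondegenerate [] u≢0 = contradiction refl u≢0
·-nondegenerate (true ∷ u) _ = true ∷ 0ᵛ , cong (true xor_) (·-zeroʳ u)
·-nondegenerate (false ∷ u) u≢0 with ·-nondegenerate u (u≢0 ∘ cong (false ∷_))
... | w , uw = false ∷ w , uw

-- Symplectic spaces over GF(2)

record SymplecticSpace : Set₁ where
  infixl 6 _⊞_
  field
    Carrier : Set
    _⊞_ : Carrier → Carrier → Carrier
    𝟘 : Carrier
    ⊞-assoc : ∀ x y z → (x ⊞ y) ⊞ z ≡ x ⊞ (y ⊞ z)
    ⊞-comm : ∀ x y → x ⊞ y ≡ y ⊞ x
    ⊞-identityˡ : ∀ x → 𝟘 ⊞ x ≡ x
    ⊞-self : ∀ x → x ⊞ x ≡ 𝟘
    ω : Carrier → Carrier → Bool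
    ω-additiveˡ : ∀ x y z → ω (x ⊞ y) z ≡ ω x z xor ω y z
    ω-sym : ∀ x y → ω x y ≡ ω y x
    ω-alternating : ∀ x → ω x x ≡ false
    ω-nondegenerate : ∀ x → x ≢ 𝟘 → ∃ λ y → ω x y ≡ true
    _≟_ : DecidableEquality Carrier
    halfDim : ℕ
    elements : List Carrier
    ∈-elements : ∀ x → x ∈ elements
    length-elements : length elements ≡ 2 ^ halfDim * 2 ^ halfDim

module Isotropy (𝕏 : SymplecticSpace) where
  open SymplecticSpace 𝕏

  Isotropic : List Carrier → Set
  Isotropic us = ∀ {u v} → u ∈ us → v ∈ us → ω u v ≡ false

  ⊞-identityʳ : ∀ x → x ⊞ 𝟘 ≡ x
  ⊞-identityʳ x = trans (⊞-comm x 𝟘) (⊞-identityˡ x)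

  ⊞-cancelʳ : ∀ x y → (x ⊞ y) ⊞ y ≡ x
  ⊞-cancelʳ x y = begin
    (x ⊞ y) ⊞ y ≡⟨ ⊞-assoc x y y ⟩
    x ⊞ (y ⊞ y) ≡⟨ cong (x ⊞_) (⊞-self y) ⟩
    x ⊞ 𝟘       ≡⟨ ⊞-identityʳ x ⟩
    x           ∎
    where open ≡-Reasoning

  ⊞-cancelˡ : ∀ x y → x ⊞ (x ⊞ y) ≡ y
  ⊞-cancelˡ x y = begin
    x ⊞ (x ⊞ y) ≡⟨ ⊞-assoc x x y ⟨
    (x ⊞ x) ⊞ y ≡⟨ cong (_⊞ y) (⊞-self x) ⟩
    𝟘 ⊞ y       ≡⟨ ⊞-identityˡ y ⟩
    y           ∎
    where open ≡-Reasoning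

  ⊞-telescope : ∀ x y z → (x ⊞ y) ⊞ (y ⊞ z) ≡ x ⊞ z
  ⊞-telescope x y z = trans (⊞-assoc x y (y ⊞ z)) (cong (x ⊞_) (⊞-cancelˡ y z))

  ⊞-injectiveʳ : ∀ {x y} z → x ⊞ z ≡ y ⊞ z → x ≡ y
  ⊞-injectiveʳ {x} {y} z eq = trans (sym (⊞-cancelʳ x z)) (trans (cong (_⊞ z) eq) (⊞-cancelʳ y z))

  ⊞-injectiveˡ : ∀ x {y z} → x ⊞ y ≡ x ⊞ z → y ≡ z
  ⊞-injectiveˡ x {y} {z} eq = ⊞-injectiveʳ x (trans (⊞-comm y x) (trans eq (⊞-comm x z)))

  ⊞-interchange : ∀ a b c d → (a ⊞ b) ⊞ (c ⊞ d) ≡ (a ⊞ c) ⊞ (b ⊞ d)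
  ⊞-interchange = CommutativeSemigroupProperties.interchange ⊞-commutativeSemigroup
    where
    ⊞-commutativeSemigroup : CommutativeSemigroup 0ℓ 0ℓ
    ⊞-commutativeSemigroup = record
      { isCommutativeSemigroup = record
        { isSemigroup = record { isMagma = isMagma _⊞_ ; assoc = ⊞-assoc }
        ; comm = ⊞-comm } }

  ω-additiveʳ : ∀ x y z → ω x (y ⊞ z) ≡ ω x y xor ω x z
  ω-additiveʳ x y z = trans (ω-sym x (y ⊞ z)) (trans (ω-additiveˡ y z x) (cong₂ _xor_ (ω-sym y x) (ω-sym z x)))

  ω-zeroˡ : ∀ y → ω 𝟘 y ≡ false
  ω-zeroˡ y = begin
    ω 𝟘 y           ≡⟨ cong (λ t → ω t y) (sym (⊞-self 𝟘)) ⟩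
    ω (𝟘 ⊞ 𝟘) y     ≡⟨ ω-additiveˡ 𝟘 𝟘 y ⟩
    ω 𝟘 y xor ω 𝟘 y ≡⟨ xor-same (ω 𝟘 y) ⟩
    false           ∎
    where open ≡-Reasoning

  radical≡𝟘 : ∀ {r} → (∀ y → ω r y ≡ false) → r ≡ 𝟘
  radical≡𝟘 {r} r⊥ with r ≟ 𝟘
  ... | yes r≡𝟘 = r≡𝟘
  ... | no r≢𝟘 = let y , ωry = ω-nondegenerate r r≢𝟘 in contradiction (trans (sym ωry) (r⊥ y)) λ ()

  scale : Bool → Carrier → Carrier
  scale c w = if c then w else 𝟘

  -- Coincides definitionally with lincomb when Carrier is V.
  comb : Vec Carrier k → Vec Bool k → Carrier
  comb ws c = foldr _ _⊞_ 𝟘 (zipWith scale c ws)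

  scale-xor : ∀ c c′ w → scale (c xor c′) w ≡ scale c w ⊞ scale c′ w
  scale-xor false c′ w = sym (⊞-identityˡ _)
  scale-xor true false w = sym (⊞-identityʳ w)
  scale-xor true true w = sym (⊞-self w)

  ω-scaleˡ : ∀ c w y → ω (scale c w) y ≡ c ∧ ω w y
  ω-scaleˡ false w y = ω-zeroˡ y
  ω-scaleˡ true w y = refl

  ω-scaleʳ : ∀ c w y → ω y (scale c w) ≡ c ∧ ω y w
  ω-scaleʳ c w y = trans (ω-sym y (scale c w)) (trans (ω-scaleˡ c w y) (cong (c ∧_) (ω-sym w y)))

  comb-0ᵛ : (ws : Vec Carrier k) → comb ws 0ᵛ ≡ 𝟘
  comb-0ᵛ [] = refl
  comb-0ᵛ (w ∷ ws) = trans (⊞-identityˡ _) (comb-0ᵛ ws)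

  comb-⊻ : (ws : Vec Carrier k) (c c′ : Vec Bool k) → comb ws (c ⊻ c′) ≡ comb ws c ⊞ comb ws c′
  comb-⊻ [] [] [] = sym (⊞-identityˡ 𝟘)
  comb-⊻ (w ∷ ws) (a ∷ c) (a′ ∷ c′) = begin
    scale (a xor a′) w ⊞ comb ws (c ⊻ c′)                ≡⟨ cong₂ _⊞_ (scale-xor a a′ w) (comb-⊻ ws c c′) ⟩
    (scale a w ⊞ scale a′ w) ⊞ (comb ws c ⊞ comb ws c′) ≡⟨ ⊞-interchange _ _ _ _ ⟩
    (scale a w ⊞ comb ws c) ⊞ (scale a′ w ⊞ comb ws c′) ∎
    where open ≡-Reasoning

  ω-combˡ : (ws : Vec Carrier k) (c : Vec Bool k) (y : Carrier) → ω (comb ws c) y ≡ c · map (λ w → ω w y) ws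
  ω-combˡ [] [] y = ω-zeroˡ y
  ω-combˡ (w ∷ ws) (a ∷ c) y =
    trans (ω-additiveˡ (scale a w) (comb ws c) y) (cong₂ _xor_ (ω-scaleˡ a w y) (ω-combˡ ws c y))

  ω-combʳ : (ws : Vec Carrier k) (c : Vec Bool k) (y : Carrier) → ω y (comb ws c) ≡ c · map (ω y) ws
  ω-combʳ ws c y = trans (ω-sym y (comb ws c)) (trans (ω-combˡ ws c y) (cong (c ·_) (map-cong (λ w → ω-sym w y) ws)))

  record DualBasis (us : List Carrier) : Set where
    field
      dim : ℕ
      basis dual : Vec Carrier dim
      basis⊆ : ∀ i → lookup basis i ∈ us
      ω-basis-dual : ∀ i j → ω (lookup basis i) (lookup dual j) ≡ δ i j
      expansion : ∀ {u} → u ∈ us → u ≡ comb basis (map (ω u) dual)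

    ·-ω-basis : ∀ c i → c · map (ω (lookup basis i)) dual ≡ lookup c i
    ·-ω-basis c i = ·-unit c _ i λ j → trans (lookup-map j _ dual) (ω-basis-dual i j)

    ·-ω-dual : ∀ c j → c · map (λ b → ω b (lookup dual j)) basis ≡ lookup c j
    ·-ω-dual c j = ·-unit c _ j λ i → trans (lookup-map i _ basis) (trans (ω-basis-dual i j) (δ-sym i j))

  -- One step of symplectic Gram–Schmidt.  If x pairs nontrivially with some vector z orthogonal to
  -- the basis, x joins the basis and z the dual family (the old duals corrected to be orthogonal
  -- to x); otherwise x minus its expansion is orthogonal to everything, hence zero.
  module Extension {us : List Carrier} (D : DualBasis us) (x : Carrier) where
    open DualBasis D

    project : Carrier → Carrier
    project y = y ⊞ comb dual (map (λ b → ω b y) basis)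

    ω-basis-project : ∀ i y → ω (lookup basis i) (project y) ≡ false
    ω-basis-project i y = begin
      ω bᵢ (y ⊞ comb dual βy)         ≡⟨ ω-additiveʳ bᵢ y _ ⟩
      ω bᵢ y xor ω bᵢ (comb dual βy)  ≡⟨ cong (ω bᵢ y xor_) (ω-combʳ dual βy bᵢ) ⟩
      ω bᵢ y xor βy · map (ω bᵢ) dual ≡⟨ cong (ω bᵢ y xor_) (·-ω-basis βy i) ⟩
      ω bᵢ y xor lookup βy i          ≡⟨ cong (ω bᵢ y xor_) (lookup-map i _ basis) ⟩
      ω bᵢ y xor ω bᵢ y               ≡⟨ xor-same (ω bᵢ y) ⟩
      false                           ∎
      where
      open ≡-Reasoning
      bᵢ : Carrier
      bᵢ = lookup basis i
      βy : Vec Bool dim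
      βy = map (λ b → ω b y) basis

    ω-span-project : ∀ c y → ω (comb basis c) (project y) ≡ false
    ω-span-project c y = begin
      ω (comb basis c) (project y)              ≡⟨ ω-combˡ basis c (project y) ⟩
      c · map (λ b → ω b (project y)) basis     ≡⟨ cong (c ·_) (map≡0ᵛ _ basis λ i → ω-basis-project i y) ⟩
      c · 0ᵛ                                    ≡⟨ ·-zeroʳ c ⟩
      false                                     ∎
      where open ≡-Reasoning

    ω-residual : ∀ y → ω (x ⊞ comb basis (map (ω x) dual)) y ≡ ω x (project y)
    ω-residual y = begin
      ω (x ⊞ comb basis γ) y       ≡⟨ ω-additiveˡ x _ y ⟩
      ω x y xor ω (comb basis γ) y ≡⟨ cong (ω x y xor_) (ω-combˡ basis γ y) ⟩
      ω x y xor γ · βy             ≡⟨ cong (ω x y xor_) (·-comm γ βy) ⟩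
      ω x y xor βy · γ             ≡⟨ cong (ω x y xor_) (ω-combʳ dual βy x) ⟨
      ω x y xor ω x (comb dual βy) ≡⟨ ω-additiveʳ x y _ ⟨
      ω x (project y)              ∎
      where
      open ≡-Reasoning
      γ βy : Vec Bool dim
      γ = map (ω x) dual
      βy = map (λ b → ω b y) basis

    absorb : (∀ y → ω x (project y) ≡ false) → DualBasis (x ∷ us)
    absorb x⊥ = record
      { dim = dim ; basis = basis ; dual = dual ; basis⊆ = there ∘ basis⊆
      ; ω-basis-dual = ω-basis-dual ; expansion = expansion′ }
      where
      expansion′ : ∀ {u} → u ∈ x ∷ us → u ≡ comb basis (map (ω u) dual)
      expansion′ (here refl) = ⊞-injectiveʳ r (trans x⊞r≡𝟘 (sym (⊞-self r)))
        where
        r : Carrier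
        r = comb basis (map (ω x) dual)
        x⊞r≡𝟘 : x ⊞ r ≡ 𝟘
        x⊞r≡𝟘 = radical≡𝟘 λ y → trans (ω-residual y) (x⊥ y)
      expansion′ (there u∈) = expansion u∈

    adjoin : ∀ y → ω x (project y) ≡ true → DualBasis (x ∷ us)
    adjoin y ωxz = record
      { dim = suc dim
      ; basis = x ∷ basis
      ; dual = z ∷ map adjust dual
      ; basis⊆ = basis⊆′
      ; ω-basis-dual = ω-basis-dual′
      ; expansion = expansion′
      }
      where
      z : Carrier
      z = project y

      adjust : Carrier → Carrier
      adjust w = w ⊞ scale (ω x w) z

      ω-adjust : ∀ u w → ω u z ≡ false → ω u (adjust w) ≡ ω u w
      ω-adjust u w ωuz = begin
        ω u (w ⊞ scale (ω x w) z)       ≡⟨ ω-additiveʳ u w _ ⟩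
        ω u w xor ω u (scale (ω x w) z) ≡⟨ cong (ω u w xor_) (ω-scaleʳ (ω x w) z u) ⟩
        ω u w xor (ω x w ∧ ω u z)       ≡⟨ cong (λ t → ω u w xor (ω x w ∧ t)) ωuz ⟩
        ω u w xor (ω x w ∧ false)       ≡⟨ cong (ω u w xor_) (Bool.∧-zeroʳ (ω x w)) ⟩
        ω u w xor false                 ≡⟨ Bool.xor-identityʳ (ω u w) ⟩
        ω u w                           ∎
        where open ≡-Reasoning

      ω-x-adjust : ∀ w → ω x (adjust w) ≡ false
      ω-x-adjust w = begin
        ω x (w ⊞ scale (ω x w) z)       ≡⟨ ω-additiveʳ x w _ ⟩
        ω x w xor ω x (scale (ω x w) z) ≡⟨ cong (ω x w xor_) (ω-scaleʳ (ω x w) z x) ⟩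
        ω x w xor (ω x w ∧ ω x z)       ≡⟨ cong (λ t → ω x w xor (ω x w ∧ t)) ωxz ⟩
        ω x w xor (ω x w ∧ true)        ≡⟨ cong (ω x w xor_) (Bool.∧-identityʳ (ω x w)) ⟩
        ω x w xor ω x w                 ≡⟨ xor-same (ω x w) ⟩
        false                           ∎
        where open ≡-Reasoning

      basis⊆′ : ∀ i → lookup (x ∷ basis) i ∈ x ∷ us
      basis⊆′ Fin.zero = here refl
      basis⊆′ (Fin.suc i) = there (basis⊆ i)

      ω-basis-dual′ : ∀ i j → ω (lookup (x ∷ basis) i) (lookup (z ∷ map adjust dual) j) ≡ δ i j
      ω-basis-dual′ Fin.zero Fin.zero = ωxz
      ω-basis-dual′ Fin.zero (Fin.suc j) =
        trans (cong (ω x) (lookup-map j adjust dual)) (ω-x-adjust _)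
      ω-basis-dual′ (Fin.suc i) Fin.zero = ω-basis-project i y
      ω-basis-dual′ (Fin.suc i) (Fin.suc j) =
        trans (cong (ω (lookup basis i)) (lookup-map j adjust dual))
              (trans (ω-adjust _ _ (ω-basis-project i y)) (ω-basis-dual i j))

      expansion′ : ∀ {u} → u ∈ x ∷ us → u ≡ comb (x ∷ basis) (map (ω u) (z ∷ map adjust dual))
      expansion′ (here refl) = sym (begin
        scale (ω x z) x ⊞ comb basis (map (ω x) (map adjust dual)) ≡⟨ cong₂ (λ c c′ → scale c x ⊞ comb basis c′) ωxz x-coordinates ⟩
        x ⊞ comb basis 0ᵛ                                           ≡⟨ cong (x ⊞_) (comb-0ᵛ basis) ⟩
        x ⊞ 𝟘                                                       ≡⟨ ⊞-identityʳ x ⟩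
        x                                                           ∎)
        where
        open ≡-Reasoning
        x-coordinates : map (ω x) (map adjust dual) ≡ 0ᵛ
        x-coordinates = map≡0ᵛ (ω x) _ λ j → trans (cong (ω x) (lookup-map j adjust dual)) (ω-x-adjust _)
      expansion′ {u} (there u∈) = trans (expansion u∈) (sym (begin
        scale (ω u z) x ⊞ comb basis (map (ω u) (map adjust dual)) ≡⟨ cong₂ (λ c c′ → scale c x ⊞ comb basis c′) ωuz u-coordinates ⟩
        𝟘 ⊞ comb basis (map (ω u) dual)                             ≡⟨ ⊞-identityˡ _ ⟩
        comb basis (map (ω u) dual)                                 ∎))
        where
        open ≡-Reasoning
        ωuz : ω u z ≡ false
        ωuz = trans (cong (λ t → ω t z) (expansion u∈)) (ω-span-project (map (ω u) dual) y)
        u-coordinates : map (ω u) (map adjust dual) ≡ map (ω u) dual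
        u-coordinates = trans (sym (map-∘ (ω u) adjust dual)) (map-cong (λ w → ω-adjust u w ωuz) dual)

    extended : DualBasis (x ∷ us)
    extended with any? (λ y → ω x (project y) Bool.≟ true) elements
    ... | yes found = let y , _ , ωxz = find found in adjoin y ωxz
    ... | no none = absorb λ y → ¬-not λ ωxz → none (lose (∈-elements y) ωxz)

  dualBasis : (us : List Carrier) → DualBasis us
  dualBasis [] = record
    { dim = 0 ; basis = [] ; dual = [] ; basis⊆ = λ () ; ω-basis-dual = λ () ; expansion = λ () }
  dualBasis (x ∷ us) = Extension.extended (dualBasis us) x

  module _ {us : List Carrier} (iso : Isotropic us) (D : DualBasis us) where
    open DualBasis D

    private
      pair : Vec Bool dim × Vec Bool dim → Carrier
      pair (a , c) = comb basis a ⊞ comb dual c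

      basis-coordinates : ∀ a → map (ω (comb basis a)) dual ≡ a
      basis-coordinates a = Vec-ext λ j → begin
        lookup (map (ω (comb basis a)) dual) j    ≡⟨ lookup-map j _ dual ⟩
        ω (comb basis a) (lookup dual j)          ≡⟨ ω-combˡ basis a _ ⟩
        a · map (λ b → ω b (lookup dual j)) basis ≡⟨ ·-ω-dual a j ⟩
        lookup a j                                ∎
        where open ≡-Reasoning

      dual-coordinates : ∀ a c → map (λ b → ω b (pair (a , c))) basis ≡ c
      dual-coordinates a c = Vec-ext λ i → begin
        lookup (map (λ b → ω b (pair (a , c))) basis) i    ≡⟨ lookup-map i _ basis ⟩
        ω (lookup basis i) (comb basis a ⊞ comb dual c)     ≡⟨ ω-additiveʳ (lookup basis i) _ _ ⟩
        ω (lookup basis i) (comb basis a) xor ω (lookup basis i) (comb dual c)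
          ≡⟨ cong₂ _xor_ (ω-basis-span i) (ω-combʳ dual c _) ⟩
        false xor c · map (ω (lookup basis i)) dual         ≡⟨ ·-ω-basis c i ⟩
        lookup c i                                          ∎
        where
        open ≡-Reasoning
        ω-basis-span : ∀ i → ω (lookup basis i) (comb basis a) ≡ false
        ω-basis-span i = trans (ω-combʳ basis a _)
          (trans (cong (a ·_) (map≡0ᵛ _ basis λ k → iso (basis⊆ i) (basis⊆ k))) (·-zeroʳ a))

      pair-injective : ∀ {p q} → pair p ≡ pair q → p ≡ q
      pair-injective {a , c} {a′ , c′} eq = cong₂ _,_ a≡a′ c≡c′
        where
        c≡c′ : c ≡ c′
        c≡c′ = trans (sym (dual-coordinates a c))
          (trans (cong (λ t → map (λ b → ω b t) basis) eq) (dual-coordinates a′ c′))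
        a≡a′ : a ≡ a′
        a≡a′ = trans (sym (basis-coordinates a))
          (trans (cong (λ t → map (ω t) dual) (⊞-injectiveʳ (comb dual c) (trans eq (cong (λ t → comb basis a′ ⊞ comb dual t) (sym c≡c′)))))
                 (basis-coordinates a′))

    -- basis ++ dual is independent: pairing with bᵢ reads off the dual coefficients (the basis
    -- being isotropic) and pairing with dⱼ the basis coefficients.
    2^dim≤2^halfDim : 2 ^ dim ≤ 2 ^ halfDim
    2^dim≤2^halfDim = m*m≤n*n⇒m≤n (begin
      2 ^ dim * 2 ^ dim                               ≡⟨ cong₂ _*_ (length-allVec dim) (length-allVec dim) ⟨
      length (allVec dim) * length (allVec dim)       ≡⟨ length-cartesianProduct (allVec dim) (allVec dim) ⟨
      length (cartesianProduct (allVec dim) (allVec dim))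
        ≡⟨ length-map pair (cartesianProduct (allVec dim) (allVec dim)) ⟨
      length (List.map pair (cartesianProduct (allVec dim) (allVec dim)))
        ≤⟨ Unique-⊆⇒length≤ (Unique.map⁺ pair-injective (Unique.cartesianProduct⁺ (allVec-unique dim) (allVec-unique dim)))
                            (λ {u} _ → ∈-elements u) ⟩
      length elements                                 ≡⟨ length-elements ⟩
      2 ^ halfDim * 2 ^ halfDim                       ∎)
      where open ≤-Reasoning

  isotropic-length≤ : ∀ {us} → Unique us → Isotropic us → length us ≤ 2 ^ halfDim
  isotropic-length≤ {us} unique iso = begin
    length us                          ≡⟨ length-map coordinates us ⟨
    length (List.map coordinates us)   ≤⟨ Unique-⊆⇒length≤ (Unique-map⁺-injectiveOn coordinates coordinates-injective unique)
                                                           (λ {c} _ → ∈-allVec c) ⟩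
    length (allVec dim)                ≡⟨ length-allVec dim ⟩
    2 ^ dim                            ≤⟨ 2^dim≤2^halfDim iso D ⟩
    2 ^ halfDim                        ∎
    where
    open ≤-Reasoning
    D : DualBasis us
    D = dualBasis us
    open DualBasis D
    coordinates : Carrier → Vec Bool dim
    coordinates u = map (ω u) dual
    coordinates-injective : ∀ {u v} → u ∈ us → v ∈ us → coordinates u ≡ coordinates v → u ≡ v
    coordinates-injective u∈ v∈ eq = trans (expansion u∈) (trans (cong (comb basis) eq) (sym (expansion v∈)))

  doubling : ∀ e {S} → Unique S → Isotropic S → (∀ {s} → s ∈ S → ω e s ≡ false) →
    (∀ {s s′} → s ∈ S → s′ ∈ S → s ≢ e ⊞ s′) → length S + length S ≤ 2 ^ halfDim
  doubling e {S} unique iso e⊥S disjoint = begin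
    length S + length S                      ≡⟨ cong (length S +_) (length-map (e ⊞_) S) ⟨
    length S + length (List.map (e ⊞_) S)    ≡⟨ length-++ S ⟨
    length T                                 ≤⟨ isotropic-length≤ T-unique T-isotropic ⟩
    2 ^ halfDim                              ∎
    where
    open ≤-Reasoning
    T : List Carrier
    T = S ++ List.map (e ⊞_) S

    T-unique : Unique T
    T-unique = Unique.++⁺ unique (Unique.map⁺ (⊞-injectiveˡ e) unique) S∩e⊞S≡∅
      where
      S∩e⊞S≡∅ : ∀ {t} → t ∈ S × t ∈ List.map (e ⊞_) S → ⊥
      S∩e⊞S≡∅ (t∈S , t∈e⊞S) with ∈-map⁻ (e ⊞_) t∈e⊞S
      ... | s′ , s′∈ , refl = disjoint t∈S s′∈ refl

    e∷S-isotropic : Isotropic (e ∷ S)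
    e∷S-isotropic (here refl) (here refl) = ω-alternating e
    e∷S-isotropic (here refl) (there v∈) = e⊥S v∈
    e∷S-isotropic (there u∈) (here refl) = trans (ω-sym _ e) (e⊥S u∈)
    e∷S-isotropic (there u∈) (there v∈) = iso u∈ v∈

    ⊥T : ∀ {u t} → u ∈ e ∷ S → t ∈ T → ω u t ≡ false
    ⊥T u∈ t∈ with ∈-++⁻ S t∈
    ... | inj₁ s∈ = e∷S-isotropic u∈ (there s∈)
    ... | inj₂ t∈e⊞S with ∈-map⁻ (e ⊞_) t∈e⊞S
    ...   | s , s∈ , refl = trans (ω-additiveʳ _ e s)
                              (cong₂ _xor_ (e∷S-isotropic u∈ (here refl)) (e∷S-isotropic u∈ (there s∈)))

    T-isotropic : Isotropic T
    T-isotropic t∈ t′∈ with ∈-++⁻ S t∈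
    ... | inj₁ s∈ = ⊥T (there s∈) t′∈
    ... | inj₂ t∈e⊞S with ∈-map⁻ (e ⊞_) t∈e⊞S
    ...   | s , s∈ , refl = trans (ω-additiveˡ e s _) (cong₂ _xor_ (⊥T (here refl) t′∈) (⊥T (there s∈) t′∈))

  isotropic-maximal : ∀ {S} → Unique S → Isotropic S → length S ≡ 2 ^ halfDim →
    (∀ {s s′} → s ∈ S → s′ ∈ S → s ⊞ s′ ∈ S) → ∀ z → (∀ {s} → s ∈ S → ω z s ≡ false) → z ∈ S
  isotropic-maximal {S} unique iso |S| closed z z⊥S = decidable-stable (DecMembership._∈?_ _≟_ z S) ¬z∉S
    where
    -- If z ∉ S, then S and z ⊞ S are disjoint, since S is closed under ⊞.
    ¬z∉S : ¬ z ∉ S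
    ¬z∉S z∉S = <⇒≱ (m^n>0 2 halfDim) (+-cancelʳ-≤ (2 ^ halfDim) (2 ^ halfDim) 0 (begin
      2 ^ halfDim + 2 ^ halfDim  ≡⟨ cong (λ n → n + n) |S| ⟨
      length S + length S        ≤⟨ doubling z unique iso z⊥S S∌z⊞S ⟩
      2 ^ halfDim                ∎))
      where
      open ≤-Reasoning
      S∌z⊞S : ∀ {s s′} → s ∈ S → s′ ∈ S → s ≢ z ⊞ s′
      S∌z⊞S {s} {s′} s∈ s′∈ s≡z⊞s′ = z∉S (subst (_∈ S) s⊞s′≡z (closed s∈ s′∈))
        where
        s⊞s′≡z : s ⊞ s′ ≡ z
        s⊞s′≡z = trans (cong (_⊞ s′) s≡z⊞s′) (⊞-cancelʳ z s′)

module StandardSymplectic (k : ℕ) where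

  Pair : Set
  Pair = Vec Bool k × Vec Bool k

  infixl 6 _⊻²_
  _⊻²_ : Pair → Pair → Pair
  (a , h) ⊻² (a′ , h′) = a ⊻ a′ , h ⊻ h′

  ω² : Pair → Pair → Bool
  ω² (a , h) (a′ , h′) = a · h′ xor a′ · h

  ω²-additiveˡ : ∀ p q r → ω² (p ⊻² q) r ≡ ω² p r xor ω² q r
  ω²-additiveˡ (a , h) (b , l) (c , m) = begin
    (a ⊻ b) · m xor c · (h ⊻ l)           ≡⟨ cong₂ _xor_ (·-⊻ˡ a b m) (·-⊻ʳ c h l) ⟩
    (a · m xor b · m) xor (c · h xor c · l) ≡⟨ xor-interchange (a · m) (b · m) (c · h) (c · l) ⟩
    (a · m xor c · h) xor (b · m xor c · l) ∎
    where open ≡-Reasoning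

  ω²-nondegenerate : ∀ p → p ≢ (0ᵛ , 0ᵛ) → ∃ λ q → ω² p q ≡ true
  ω²-nondegenerate (a , h) p≢0 with Vec.≡-dec Bool._≟_ a 0ᵛ
  ... | no a≢0 = let w , aw = ·-nondegenerate a a≢0 in
    (0ᵛ , w) , trans (cong (a · w xor_) (trans (·-comm 0ᵛ h) (·-zeroʳ h))) (trans (Bool.xor-identityʳ _) aw)
  ... | yes refl = let w , hw = ·-nondegenerate h (p≢0 ∘ cong (0ᵛ ,_)) in
    (w , 0ᵛ) , trans (cong (_xor w · h) (·-zeroʳ {k} 0ᵛ)) (trans (·-comm w h) hw)

  space : SymplecticSpace
  space = record
    { Carrier = Pair
    ; _⊞_ = _⊻²_
    ; 𝟘 = 0ᵛ , 0ᵛ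
    ; ⊞-assoc = λ (a , h) (b , l) (c , m) → cong₂ _,_ (⊻-assoc a b c) (⊻-assoc h l m)
    ; ⊞-comm = λ (a , h) (b , l) → cong₂ _,_ (⊻-comm a b) (⊻-comm h l)
    ; ⊞-identityˡ = λ (a , h) → cong₂ _,_ (⊻-identityˡ a) (⊻-identityˡ h)
    ; ⊞-self = λ (a , h) → cong₂ _,_ (⊻-self a) (⊻-self h)
    ; ω = ω²
    ; ω-additiveˡ = ω²-additiveˡ
    ; ω-sym = λ (a , h) (b , l) → xor-comm (a · l) (b · h)
    ; ω-alternating = λ (a , h) → xor-same (a · h)
    ; ω-nondegenerate = ω²-nondegenerate
    ; _≟_ = ×-≡-dec (Vec.≡-dec Bool._≟_) (Vec.≡-dec Bool._≟_)
    ; halfDim = k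
    ; elements = cartesianProduct (allVec k) (allVec k)
    ; ∈-elements = λ (a , h) → ∈-cartesianProduct⁺ (∈-allVec a) (∈-allVec h)
    ; length-elements = trans (length-cartesianProduct (allVec k) (allVec k))
                              (cong₂ _*_ (length-allVec k) (length-allVec k))
    }

-- Quadratic functions on GF(2)ᵏ

-- polar a is Δ (evalQ a), definitionally.
Δ : (Vec Bool k → Bool) → Vec Bool k → Vec Bool k → Bool
Δ f x y = f (x ⊻ y) xor (f x xor f y)

IsQuadratic : (Vec Bool k → Bool) → Set
IsQuadratic f = ∀ x x′ y → Δ f (x ⊻ x′) y ≡ Δ f x y xor Δ f x′ y

Additive : (Vec Bool k → Bool) → Set
Additive ℓ = ∀ x y → ℓ (x ⊻ y) ≡ ℓ x xor ℓ y

lookup-additive : (i : Fin k) → Additive (λ x → lookup x i)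
lookup-additive i x y = lookup-zipWith _xor_ i x y

product-isQuadratic : ∀ {ℓ ℓ′ : Vec Bool k → Bool} → Additive ℓ → Additive ℓ′ →
  ∀ c → IsQuadratic (λ x → c ∧ (ℓ x ∧ ℓ′ x))
product-isQuadratic {ℓ = ℓ} {ℓ′} ℓ+ ℓ′+ c x x′ y
  rewrite ℓ+ (x ⊻ x′) y | ℓ+ x x′ | ℓ+ x y | ℓ+ x′ y
        | ℓ′+ (x ⊻ x′) y | ℓ′+ x x′ | ℓ′+ x y | ℓ′+ x′ y
  = identity c (ℓ x) (ℓ x′) (ℓ y) (ℓ′ x) (ℓ′ x′) (ℓ′ y)
  where
  identity : ∀ c u u′ v w w′ t →
    c ∧ (((u xor u′) xor v) ∧ ((w xor w′) xor t)) xor ((c ∧ ((u xor u′) ∧ (w xor w′))) xor (c ∧ (v ∧ t)))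
      ≡ (c ∧ ((u xor v) ∧ (w xor t)) xor ((c ∧ (u ∧ w)) xor (c ∧ (v ∧ t))))
        xor (c ∧ ((u′ xor v) ∧ (w′ xor t)) xor ((c ∧ (u′ ∧ w′)) xor (c ∧ (v ∧ t))))
  identity = solve-∀ GF₂

Δ-xor : (f g : Vec Bool k → Bool) → ∀ x y → Δ (λ z → f z xor g z) x y ≡ Δ f x y xor Δ g x y
Δ-xor f g x y = identity (f (x ⊻ y)) (g (x ⊻ y)) (f x) (g x) (f y) (g y)
  where
  identity : ∀ p q r s t u → (p xor q) xor ((r xor s) xor (t xor u)) ≡ (p xor (r xor t)) xor (q xor (s xor u))
  identity = solve-∀ GF₂

xor-isQuadratic : ∀ {f g : Vec Bool k → Bool} → IsQuadratic f → IsQuadratic g → IsQuadratic (λ z → f z xor g z)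
xor-isQuadratic {f = f} {g} qf qg x x′ y = begin
  Δ (λ z → f z xor g z) (x ⊻ x′) y                         ≡⟨ Δ-xor f g (x ⊻ x′) y ⟩
  Δ f (x ⊻ x′) y xor Δ g (x ⊻ x′) y                        ≡⟨ cong₂ _xor_ (qf x x′ y) (qg x x′ y) ⟩
  (Δ f x y xor Δ f x′ y) xor (Δ g x y xor Δ g x′ y)        ≡⟨ xor-interchange (Δ f x y) (Δ f x′ y) (Δ g x y) (Δ g x′ y) ⟩
  (Δ f x y xor Δ g x y) xor (Δ f x′ y xor Δ g x′ y)        ≡⟨ cong₂ _xor_ (Δ-xor f g x y) (Δ-xor f g x′ y) ⟨
  Δ (λ z → f z xor g z) x y xor Δ (λ z → f z xor g z) x′ y ∎
  where open ≡-Reasoning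

bsum-isQuadratic : (fs : List (Vec Bool k → Bool)) → All IsQuadratic fs →
  IsQuadratic (λ x → bsum (List.map (λ f → f x) fs))
bsum-isQuadratic [] [] x x′ y = refl
bsum-isQuadratic (f ∷ fs) (qf ∷ qfs) =
  xor-isQuadratic {f = f} {g = λ x → bsum (List.map (λ f → f x) fs)} qf (bsum-isQuadratic fs qfs)

isQuadratic-0ᵛ : ∀ {f : Vec Bool k → Bool} → IsQuadratic f → f 0ᵛ ≡ false
isQuadratic-0ᵛ {f = f} q = begin
  f 0ᵛ                    ≡⟨ identity (f 0ᵛ) ⟩
  f 0ᵛ xor (f 0ᵛ xor f 0ᵛ) ≡⟨ cong (λ u → f u xor (f 0ᵛ xor f 0ᵛ)) (⊻-self 0ᵛ) ⟨
  Δ f 0ᵛ 0ᵛ               ≡⟨ cong (λ u → Δ f u 0ᵛ) (⊻-self 0ᵛ) ⟨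
  Δ f (0ᵛ ⊻ 0ᵛ) 0ᵛ        ≡⟨ q 0ᵛ 0ᵛ 0ᵛ ⟩
  Δ f 0ᵛ 0ᵛ xor Δ f 0ᵛ 0ᵛ ≡⟨ xor-same (Δ f 0ᵛ 0ᵛ) ⟩
  false                   ∎
  where
  open ≡-Reasoning
  identity : ∀ p → p ≡ p xor (p xor p)
  identity = solve-∀ GF₂

Δ-sym : (f : Vec Bool k → Bool) → ∀ x y → Δ f x y ≡ Δ f y x
Δ-sym f x y = cong₂ _xor_ (cong f (⊻-comm x y)) (xor-comm (f x) (f y))

Δ-alternating : ∀ {f : Vec Bool k → Bool} → IsQuadratic f → ∀ x → Δ f x x ≡ false
Δ-alternating {f = f} q x = cong₂ _xor_ (trans (cong f (⊻-self x)) (isQuadratic-0ᵛ {f = f} q)) (xor-same (f x))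

Δ-expansion : (f : Vec Bool k → Bool) → ∀ x y → f (x ⊻ y) ≡ f x xor (f y xor Δ f x y)
Δ-expansion f x y = identity (f (x ⊻ y)) (f x) (f y)
  where
  identity : ∀ p q r → p ≡ q xor (r xor (p xor (q xor r)))
  identity = solve-∀ GF₂

monomial : QForm → Fin 8 → Fin 8 → V → Bool
monomial a i j x = lookup (lookup a i) j ∧ (lookup x i ∧ lookup x j)

-- evalQ a x unfolds definitionally to the sum of the monomials of a evaluated at x.
monomials : QForm → List (V → Bool)
monomials a = concat (List.map (λ i → List.map (monomial a i) (allFin 8)) (allFin 8))

evalQ-isQuadratic : (a : QForm) → IsQuadratic (evalQ a)
evalQ-isQuadratic a = bsum-isQuadratic (monomials a) (All.concat⁺ (All.map⁺ (All.universal row (allFin 8))))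
  where
  row : ∀ i → All IsQuadratic (List.map (monomial a i) (allFin 8))
  row i = All.map⁺ {P = IsQuadratic} {f = monomial a i} (All.universal (λ j →
    product-isQuadratic {ℓ = λ x → lookup x i} {ℓ′ = λ x → lookup x j} (lookup-additive i) (lookup-additive j) (lookup (lookup a i) j))
    (allFin 8))

-- The quadric and its two graphs

module QuadraticSpace (Q : V → Bool) (Q-quadratic : IsQuadratic Q)
                      (Q-nondegenerate : ∀ x → x ≢ 0v → ∃ λ y → Δ Q x y ≡ true) where

  polarSpace : SymplecticSpace
  polarSpace = record
    { Carrier = V
    ; _⊞_ = _⊕_
    ; 𝟘 = 0v
    ; ⊞-assoc = ⊻-assoc
    ; ⊞-comm = ⊻-comm
    ; ⊞-identityˡ = ⊻-identityˡ
    ; ⊞-self = ⊻-self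
    ; ω = Δ Q
    ; ω-additiveˡ = Q-quadratic
    ; ω-sym = Δ-sym Q
    ; ω-alternating = Δ-alternating {f = Q} Q-quadratic
    ; ω-nondegenerate = Q-nondegenerate
    ; _≟_ = Vec.≡-dec Bool._≟_
    ; halfDim = 4
    ; elements = allVec 8
    ; ∈-elements = ∈-allVec
    ; length-elements = length-allVec 8
    }

  open SymplecticSpace polarSpace using (ω-additiveˡ; ω-sym)
  open Isotropy polarSpace

  Δ-singular : ∀ {x y} → Q x ≡ false → Q y ≡ false → Q (x ⊕ y) ≡ false → Δ Q x y ≡ false
  Δ-singular qx qy qxy = cong₂ _xor_ qxy (cong₂ _xor_ qx qy)

  nonsingular-isotropic-length≤8 : ∀ {xs} → Unique xs → (∀ {x} → x ∈ xs → Q x ≡ true) → Isotropic xs → length xs ≤ 8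
  nonsingular-isotropic-length≤8 {[]} _ _ _ = z≤n
  nonsingular-isotropic-length≤8 {xs@(x₀ ∷ _)} unique nonsingular isotropic =
    m+m≤n+n⇒m≤n {n = 8} (doubling x₀ unique isotropic (isotropic (here refl)) translate-disjoint)
    where
    translate-disjoint : ∀ {s s′} → s ∈ xs → s′ ∈ xs → s ≢ x₀ ⊕ s′
    translate-disjoint {s} {s′} s∈ s′∈ s≡x₀⊕s′ =
      contradiction (trans (sym (nonsingular s∈)) (trans (cong Q s≡x₀⊕s′) Q[x₀⊕s′]≡false)) λ ()
      where
      Q[x₀⊕s′]≡false : Q (x₀ ⊕ s′) ≡ false
      Q[x₀⊕s′]≡false = trans (Δ-expansion Q x₀ s′)
        (cong₂ _xor_ (nonsingular (here refl)) (cong₂ _xor_ (nonsingular s′∈) (isotropic (here refl) s′∈)))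

  module Generator (g : Vec V 4) (g-independent : ∀ c → lincomb g c ≡ 0v → c ≡ 0ᵛ)
                   (g-singular : ∀ c → Q (lincomb g c) ≡ false) where
    module ℙ = Isotropy (StandardSymplectic.space 4)
    open StandardSymplectic 4 using (Pair; _⊻²_; ω²)

    Π : List V
    Π = List.map (lincomb g) (allVec 4)

    span-𝟘 : InSpan g 0v
    span-𝟘 = 0ᵛ , comb-0ᵛ g

    span-⊕ : ∀ {x y} → InSpan g x → InSpan g y → InSpan g (x ⊕ y)
    span-⊕ (c , refl) (c′ , refl) = c ⊻ c′ , comb-⊻ g c c′

    span-cancel : ∀ {x y} → InSpan g x → InSpan g (x ⊕ y) → InSpan g y
    span-cancel {x} {y} sx sxy = subst (InSpan g) (⊞-cancelˡ x y) (span-⊕ sx sxy)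

    span-singular : ∀ {x} → InSpan g x → Q x ≡ false
    span-singular (c , refl) = g-singular c

    lincomb-injective : ∀ {c c′} → lincomb g c ≡ lincomb g c′ → c ≡ c′
    lincomb-injective {c} {c′} eq = ⊻≡0ᵛ⇒≡ c c′ (g-independent (c ⊻ c′) (begin
      lincomb g (c ⊻ c′)          ≡⟨ comb-⊻ g c c′ ⟩
      lincomb g c ⊕ lincomb g c′  ≡⟨ cong (_⊕ lincomb g c′) eq ⟩
      lincomb g c′ ⊕ lincomb g c′ ≡⟨ ⊻-self (lincomb g c′) ⟩
      0v                          ∎))
      where open ≡-Reasoning

    InSpan⇒∈Π : ∀ {x} → InSpan g x → x ∈ Π
    InSpan⇒∈Π (c , refl) = ∈-map⁺ (lincomb g) (∈-allVec c)

    ∈Π⇒InSpan : ∀ {x} → x ∈ Π → InSpan g x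
    ∈Π⇒InSpan x∈Π with ∈-map⁻ (lincomb g) {xs = allVec 4} x∈Π
    ... | c , _ , refl = c , refl

    Π-maximal : ∀ z → (∀ c → Δ Q z (lincomb g c) ≡ false) → InSpan g z
    Π-maximal z z⊥Π = ∈Π⇒InSpan
      (isotropic-maximal Π-unique Π-isotropic Π-length Π-closed z (∀-∈-map (lincomb g) {xs = allVec 4} λ {c} _ → z⊥Π c))
      where
      Π-unique : Unique Π
      Π-unique = Unique.map⁺ lincomb-injective (allVec-unique 4)
      Π-isotropic : Isotropic Π
      Π-isotropic {u} {v} u∈ v∈ = Δ-singular (span-singular su) (span-singular sv) (span-singular (span-⊕ su sv))
        where
        su : InSpan g u
        su = ∈Π⇒InSpan u∈
        sv : InSpan g v
        sv = ∈Π⇒InSpan v∈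
      Π-length : length Π ≡ 2 ^ 4
      Π-length = trans (length-map (lincomb g) (allVec 4)) (length-allVec 4)
      Π-closed : ∀ {s s′} → s ∈ Π → s′ ∈ Π → s ⊕ s′ ∈ Π
      Π-closed s∈ s′∈ = InSpan⇒∈Π (span-⊕ (∈Π⇒InSpan s∈) (∈Π⇒InSpan s′∈))

    φ : V → Vec Bool 4
    φ x = map (Δ Q x) g

    Δ-lincomb : ∀ x c → Δ Q x (lincomb g c) ≡ c · φ x
    Δ-lincomb x c = ω-combʳ g c x

    φ-⊕ : ∀ x y → φ (x ⊕ y) ≡ φ x ⊻ φ y
    φ-⊕ x y = Vec-ext λ i → begin
      lookup (φ (x ⊕ y)) i                          ≡⟨ lookup-map i _ g ⟩
      Δ Q (x ⊕ y) (lookup g i)                      ≡⟨ ω-additiveˡ x y _ ⟩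
      Δ Q x (lookup g i) xor Δ Q y (lookup g i)     ≡⟨ cong₂ _xor_ (lookup-map i _ g) (lookup-map i _ g) ⟨
      lookup (φ x) i xor lookup (φ y) i             ≡⟨ lookup-zipWith _xor_ i (φ x) (φ y) ⟨
      lookup (φ x ⊻ φ y) i                          ∎
      where open ≡-Reasoning

    φ≡⇒congruent : ∀ {x y} → φ x ≡ φ y → InSpan g (x ⊕ y)
    φ≡⇒congruent {x} {y} φx≡φy = Π-maximal (x ⊕ y) λ c → begin
      Δ Q (x ⊕ y) (lincomb g c) ≡⟨ Δ-lincomb (x ⊕ y) c ⟩
      c · φ (x ⊕ y)             ≡⟨ cong (c ·_) (φ-⊕ x y) ⟩
      c · (φ x ⊻ φ y)           ≡⟨ cong (λ t → c · (t ⊻ φ y)) φx≡φy ⟩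
      c · (φ y ⊻ φ y)           ≡⟨ cong (c ·_) (⊻-self (φ y)) ⟩
      c · 0ᵛ                    ≡⟨ ·-zeroʳ c ⟩
      false                     ∎
      where open ≡-Reasoning

    search-coordinatesΠ : ∀ z → Dec (Any (λ c → lincomb g c ≡ z) (allVec 4))
    search-coordinatesΠ z = any? (λ c → Vec.≡-dec Bool._≟_ (lincomb g c) z) (allVec 4)

    coordinatesΠ : V → Vec Bool 4
    coordinatesΠ z = choose (search-coordinatesΠ z) 0ᵛ

    lincomb-coordinatesΠ : ∀ {z} → InSpan g z → lincomb g (coordinatesΠ z) ≡ z
    lincomb-coordinatesΠ {z} (c , refl) = proj₂ (choose-spec (search-coordinatesΠ z) 0ᵛ (lose (∈-allVec c) refl))

    module Clique {xs : List V} (unique : Unique xs)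
                  (singular : ∀ {x} → x ∈ xs → Q x ≡ false) (outside : ∀ {x} → x ∈ xs → ¬ InSpan g x)
                  (orthogonal⇒congruent : ∀ {x y} → x ∈ xs → y ∈ xs → Δ Q x y ≡ false → InSpan g (x ⊕ y)) where

      congruent⇒orthogonal : ∀ {x y} → x ∈ xs → y ∈ xs → InSpan g (x ⊕ y) → Δ Q x y ≡ false
      congruent⇒orthogonal x∈ y∈ x≅y = Δ-singular (singular x∈) (singular y∈) (span-singular x≅y)

      Δ-congruent : ∀ {x y y′} → x ∈ xs → y ∈ xs → y′ ∈ xs → InSpan g (y ⊕ y′) → Δ Q x y ≡ Δ Q x y′
      Δ-congruent {x} {y} {y′} x∈ y∈ y′∈ y≅y′ = false⇔false⇒≡
        (λ x⊥y → congruent⇒orthogonal x∈ y′∈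
          (subst (InSpan g) (⊞-telescope x y y′) (span-⊕ (orthogonal⇒congruent x∈ y∈ x⊥y) y≅y′)))
        (λ x⊥y′ → congruent⇒orthogonal x∈ y∈
          (subst (InSpan g) (⊞-telescope x y′ y) (span-⊕ (orthogonal⇒congruent x∈ y′∈ x⊥y′) (subst (InSpan g) (⊻-comm y y′) y≅y′))))

      -- Q(u ⊕ v ⊕ w) = B(u, v) + B(u, w) + B(v, w), so some pair is orthogonal, hence congruent
      -- modulo Π, and then the third point would lie in Π.
      sum-of-three∉Π : ∀ {u v w} → u ∈ xs → v ∈ xs → w ∈ xs → ¬ InSpan g (u ⊕ (v ⊕ w))
      sum-of-three∉Π {u} {v} {w} u∈ v∈ w∈ s with Δ Q u v in uv | Δ Q u w in uw | Δ Q v w in vw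
      ... | false | _ | _ =
        outside w∈ (span-cancel (orthogonal⇒congruent u∈ v∈ uv) (subst (InSpan g) (sym (⊻-assoc u v w)) s))
      ... | _ | false | _ =
        outside v∈ (span-cancel (orthogonal⇒congruent u∈ w∈ uw) (subst (InSpan g) u⊕[v⊕w]≡[u⊕w]⊕v s))
        where
        u⊕[v⊕w]≡[u⊕w]⊕v : u ⊕ (v ⊕ w) ≡ (u ⊕ w) ⊕ v
        u⊕[v⊕w]≡[u⊕w]⊕v = trans (cong (u ⊕_) (⊻-comm v w)) (sym (⊻-assoc u w v))
      ... | _ | _ | false =
        outside u∈ (span-cancel (orthogonal⇒congruent v∈ w∈ vw) (subst (InSpan g) (⊻-comm u (v ⊕ w)) s))
      ... | true | true | true = contradiction (trans (sym (span-singular s)) Q[u⊕v⊕w]≡true) λ ()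
        where
        Q[u⊕v⊕w]≡true : Q (u ⊕ (v ⊕ w)) ≡ true
        Q[u⊕v⊕w]≡true = begin
          Q (u ⊕ (v ⊕ w))
            ≡⟨ Δ-expansion Q u (v ⊕ w) ⟩
          Q u xor (Q (v ⊕ w) xor Δ Q u (v ⊕ w))
            ≡⟨ cong₂ (λ s t → Q u xor (s xor t)) (Δ-expansion Q v w) (ω-additiveʳ u v w) ⟩
          Q u xor ((Q v xor (Q w xor Δ Q v w)) xor (Δ Q u v xor Δ Q u w))
            ≡⟨ cong₂ _xor_ (singular u∈) (cong₂ _xor_ (cong₂ _xor_ (singular v∈) (cong₂ _xor_ (singular w∈) vw)) (cong₂ _xor_ uv uw)) ⟩
          true ∎
          where open ≡-Reasoning

      search-representative : ∀ c → Dec (Any (λ w → φ w ≡ c) xs)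
      search-representative c = any? (λ w → Vec.≡-dec Bool._≟_ (φ w) c) xs

      representative : Vec Bool 4 → V
      representative c = choose (search-representative c) 0v

      representative-spec : ∀ {x} → x ∈ xs → representative (φ x) ∈ xs × φ (representative (φ x)) ≡ φ x
      representative-spec {x} x∈ = choose-spec (search-representative (φ x)) 0v (lose x∈ refl)

      rep : V → V
      rep x = representative (φ x)

      rep-congruent : ∀ {x} → x ∈ xs → InSpan g (x ⊕ rep x)
      rep-congruent x∈ = φ≡⇒congruent (sym (proj₂ (representative-spec x∈)))

      offset : V → Vec Bool 4
      offset x = coordinatesΠ (x ⊕ rep x)

      η : V → Pair
      η x = φ x , offset x

      φ·offset≡false : ∀ {x y} → x ∈ xs → y ∈ xs → φ x · offset y ≡ false
      φ·offset≡false {x} {y} x∈ y∈ = begin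
        φ x · offset y                  ≡⟨ ·-comm (φ x) (offset y) ⟩
        offset y · φ x                  ≡⟨ Δ-lincomb x (offset y) ⟨
        Δ Q x (lincomb g (offset y))    ≡⟨ cong (Δ Q x) (lincomb-coordinatesΠ (rep-congruent y∈)) ⟩
        Δ Q x (y ⊕ rep y)               ≡⟨ ω-additiveʳ x y (rep y) ⟩
        Δ Q x y xor Δ Q x (rep y)       ≡⟨ cong (Δ Q x y xor_) (Δ-congruent x∈ y∈ (proj₁ (representative-spec y∈)) (rep-congruent y∈)) ⟨
        Δ Q x y xor Δ Q x y             ≡⟨ xor-same (Δ Q x y) ⟩
        false                           ∎
        where open ≡-Reasoning

      η-injective : ∀ {x y} → x ∈ xs → y ∈ xs → η x ≡ η y → x ≡ y
      η-injective {x} {y} x∈ y∈ ηx≡ηy = ⊞-injectiveʳ (rep x) (begin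
        x ⊕ rep x              ≡⟨ lincomb-coordinatesΠ (rep-congruent x∈) ⟨
        lincomb g (offset x)   ≡⟨ cong (λ p → lincomb g (proj₂ p)) ηx≡ηy ⟩
        lincomb g (offset y)   ≡⟨ lincomb-coordinatesΠ (rep-congruent y∈) ⟩
        y ⊕ rep y              ≡⟨ cong (λ c → y ⊕ representative c) (cong proj₁ ηx≡ηy) ⟨
        y ⊕ rep x              ∎)
        where open ≡-Reasoning

      length≤8 : ∀ {x₀} → x₀ ∈ xs → length xs ≤ 8
      length≤8 {x₀} x₀∈ = m+m≤n+n⇒m≤n {n = 8} (subst (λ n → n + n ≤ 16) (length-map η xs)
        (ℙ.doubling e (Unique-map⁺-injectiveOn η η-injective unique) η-isotropic e⊥ translate-disjoint))
        where
        e : Pair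
        e = φ x₀ , 0ᵛ

        η-isotropic : ℙ.Isotropic (List.map η xs)
        η-isotropic u∈ v∈ = ∀-∈-map η (λ x∈ → ∀-∈-map η (λ y∈ →
          cong₂ _xor_ (φ·offset≡false x∈ y∈) (φ·offset≡false y∈ x∈)) v∈) u∈

        e⊥ : ∀ {s} → s ∈ List.map η xs → ω² e s ≡ false
        e⊥ = ∀-∈-map η λ {y} y∈ → cong₂ _xor_ (φ·offset≡false x₀∈ y∈) (·-zeroʳ (φ y))

        translate-disjoint : ∀ {s s′} → s ∈ List.map η xs → s′ ∈ List.map η xs → s ≢ e ⊻² s′
        translate-disjoint {s′ = s′} s∈ s′∈ =
          ∀-∈-map {P = λ s → s ≢ e ⊻² s′} η (λ {x} x∈ → ∀-∈-map {P = λ s′ → η x ≢ e ⊻² s′} η (λ {y} y∈ ηx≡e⊻²ηy →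
            sum-of-three∉Π x∈ x₀∈ y∈ (φ≡⇒congruent (trans (cong proj₁ ηx≡e⊻²ηy) (sym (φ-⊕ x₀ y))))) s′∈) s∈

tangent⇒polar≡false : ∀ a x y → evalQ a x ≡ true → evalQ a y ≡ true → Tangent a x y → polar a x y ≡ false
tangent⇒polar≡false a x y = count (evalQ a x) (evalQ a y) (evalQ a (x ⊕ y))
  where
  count : ∀ p q r → p ≡ true → q ≡ true → b2n (not p) + (b2n (not q) + b2n (not r)) ≡ 1 → r xor (p xor q) ≡ false
  count true true false refl refl _ = refl
  count true true true refl refl ()

secant⇒polar≡true : ∀ a x y → evalQ a x ≡ false → evalQ a y ≡ false → Secant a x y → polar a x y ≡ true
secant⇒polar≡true a x y = count (evalQ a x) (evalQ a y) (evalQ a (x ⊕ y))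
  where
  count : ∀ p q r → p ≡ false → q ≡ false → b2n (not p) + (b2n (not q) + b2n (not r)) ≡ 2 → r xor (p xor q) ≡ true
  count false false true refl refl _ = refl
  count false false false refl refl ()

NO-clique-length≤8 : ∀ a → NonDegenerate a → (xs : List V) → All (VertexNO a) xs → AllPairs (AdjNO a) xs → length xs ≤ 8
NO-clique-length≤8 a nd xs vertices adjacent = nonsingular-isotropic-length≤8 (AllPairs.map proj₁ adjacent) nonsingular isotropic
  where
  open QuadraticSpace (evalQ a) (evalQ-isQuadratic a) nd
  open Isotropy polarSpace using (Isotropic)

  nonsingular : ∀ {x} → x ∈ xs → evalQ a x ≡ true
  nonsingular x∈ = ¬-not (proj₂ (All.lookup vertices x∈))

  isotropic : Isotropic xs
  isotropic {u} {v} u∈ v∈ with AllPairs-lookup adjacent u∈ v∈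
  ... | inj₁ refl = Δ-alternating {f = evalQ a} (evalQ-isQuadratic a) u
  ... | inj₂ (inj₁ (_ , tangent)) = tangent⇒polar≡false a u v (nonsingular u∈) (nonsingular v∈) tangent
  ... | inj₂ (inj₂ (_ , tangent)) = trans (Δ-sym (evalQ a) u v) (tangent⇒polar≡false a v u (nonsingular v∈) (nonsingular u∈) tangent)

G3-clique-length≤8 : ∀ a → NonDegenerate a → (g : Vec V 4) → IsGenerator a g →
  (xs : List V) → All (VertexG3 a g) xs → AllPairs (AdjG3 a g) xs → length xs ≤ 8
G3-clique-length≤8 _ _ _ _ [] _ _ = z≤n
G3-clique-length≤8 a nd g (g-independent , g-singular) xs@(_ ∷ _) vertices adjacent =
  Clique.length≤8 (AllPairs.map proj₁ adjacent) singular outside orthogonal⇒congruent (here refl)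
  where
  open QuadraticSpace (evalQ a) (evalQ-isQuadratic a) nd
  open Generator g g-independent g-singular

  singular : ∀ {x} → x ∈ xs → evalQ a x ≡ false
  singular x∈ = proj₁ (proj₂ (All.lookup vertices x∈))

  outside : ∀ {x} → x ∈ xs → ¬ InSpan g x
  outside x∈ = proj₂ (proj₂ (All.lookup vertices x∈))

  adjacent⇒congruent : ∀ {x y} → x ∈ xs → y ∈ xs → Secant a x y ⊎ (ContainedInQ a x y × MeetsSpan g x y) →
    polar a x y ≡ false → InSpan g (x ⊕ y)
  adjacent⇒congruent {x} {y} x∈ y∈ (inj₁ secant) x⊥y =
    contradiction (trans (sym (secant⇒polar≡true a x y (singular x∈) (singular y∈) secant)) x⊥y) λ ()
  adjacent⇒congruent x∈ _ (inj₂ (_ , inj₁ x∈Π)) _ = contradiction x∈Π (outside x∈)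
  adjacent⇒congruent _ y∈ (inj₂ (_ , inj₂ (inj₁ y∈Π))) _ = contradiction y∈Π (outside y∈)
  adjacent⇒congruent _ _ (inj₂ (_ , inj₂ (inj₂ x⊕y∈Π))) _ = x⊕y∈Π

  orthogonal⇒congruent : ∀ {x y} → x ∈ xs → y ∈ xs → polar a x y ≡ false → InSpan g (x ⊕ y)
  orthogonal⇒congruent {x} {y} x∈ y∈ x⊥y with AllPairs-lookup adjacent x∈ y∈
  ... | inj₁ refl = subst (InSpan g) (sym (⊻-self x)) span-𝟘
  ... | inj₂ (inj₁ (_ , adj)) = adjacent⇒congruent x∈ y∈ adj x⊥y
  ... | inj₂ (inj₂ (_ , adj)) =
    subst (InSpan g) (⊻-comm y x) (adjacent⇒congruent y∈ x∈ adj (trans (Δ-sym (evalQ a) y x) x⊥y))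

corollary4p3 : (a : QForm) → Hyperbolic a →
    ((xs : List V) → All (VertexNO a) xs → AllPairs (AdjNO a) xs → length xs ≤ 8) ×
    ((g : Vec V 4) → IsGenerator a g →
      (xs : List V) → All (VertexG3 a g) xs → AllPairs (AdjG3 a g) xs → length xs ≤ 8)
corollary4p3 a (nd , _) = NO-clique-length≤8 a nd , G3-clique-length≤8 a nd
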